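{- For every integer $n$ that is an even power of $2$ with $n\ge 4$ (i.e. $n=4^m$ with $m\ge 1$), there exists an $(n/4,\,2(\log_2 n+1))$-Ruzsa–Szemerédi graph on $n$ vertices.
   Context: All graphs are finite and simple. A matching $M$ in a graph $G$ is an induced matching if the subgraph of $G$ induced on the set of vertices covered by $M$ has edge set exactly $M$. A graph $G$ is an $(r,t)$-Ruzsa–Szemerédi graph if its edge set can be partitioned into $t$ pairwise edge-disjoint induced matchings, each consisting of exactly $r$ edges. -}

module Defs where

open import Data.Nat using (ℕ; _<_; _^_; _*_; _+_; suc)
open import Data.Fin using (Fin; toℕ)
open import Data.Product using (Σ; _×_; _,_; proj₁; proj₂)
open import Data.Sum using (_⊎_)
open import Relation.Binary.PropositionalEquality using (_≡_)
open import Relation.Nullary using (¬_)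

record SimpleGraph (n : ℕ) : Set₁ where
  field
    Adj      : Fin n → Fin n → Set
    symm     : ∀ {u v} → Adj u v → Adj v u
    irrefl   : ∀ {u} → ¬ Adj u u

open SimpleGraph public

-- An edge is represented by an ordered pair of endpoints (u , v) with
-- toℕ u < toℕ v (so each unordered edge has exactly one representation).
Edge : ∀ {n} → SimpleGraph n → Set
Edge {n} G = Σ (Fin n × Fin n) λ e → (toℕ (proj₁ e) < toℕ (proj₂ e)) × Adj G (proj₁ e) (proj₂ e)

IsInducedMatching : ∀ {n r} (G : SimpleGraph n) → (Fin r → Fin n × Fin n) → Set
IsInducedMatching {n} {r} G M =
    (∀ i → toℕ (proj₁ (M i)) < toℕ (proj₂ (M i)) × Adj G (proj₁ (M i)) (proj₂ (M i)))
  × (∀ i j → M i ≡ M j → i ≡ j)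
  × (∀ i j → ¬ (i ≡ j) → (proj₁ (M i) ≢' proj₁ (M j)) × (proj₁ (M i) ≢' proj₂ (M j)) × (proj₂ (M i) ≢' proj₂ (M j)))
  × (∀ (x y : Fin n) → Covered x → Covered y → Adj G x y →
       Σ (Fin r) λ i → ((proj₁ (M i) ≡ x) × (proj₂ (M i) ≡ y)) ⊎ ((proj₁ (M i) ≡ y) × (proj₂ (M i) ≡ x)))
  where
    _≢'_ : Fin n → Fin n → Set
    a ≢' b = ¬ (a ≡ b)
    Covered : Fin n → Set
    Covered x = Σ (Fin r) λ i → (proj₁ (M i) ≡ x) ⊎ (proj₂ (M i) ≡ x)

IsRuzsaSzemeredi : ∀ {n} → SimpleGraph n → (r t : ℕ) → Set
IsRuzsaSzemeredi {n} G r t =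
  Σ (Fin t → Fin r → Fin n × Fin n) λ M →
      (∀ k → IsInducedMatching G (M k))
    × (∀ (e : Edge G) → Σ (Fin t × Fin r) λ ki →
          (M (proj₁ ki) (proj₂ ki) ≡ proj₁ e)
        × (∀ (kj : Fin t × Fin r) → M (proj₁ kj) (proj₂ kj) ≡ proj₁ e → kj ≡ ki))

module Submission where

-- Take the even binary words of length
-- N = 2 m + 3; there are 2 ^ (N - 1) = 4 ^ (m + 1) of them.  For each
-- coordinate c and bit b, the matching (c , b) joins every even word Z with
-- Z c = b to its antipode through c (the word agreeing with Z at c and
-- complementary elsewhere; it is even because N - 1 is even).  This gives
-- 2 N matchings of 2 ^ (N - 3) = 4 ^ m edges.  Each is induced in the union:
-- the two ends of an edge of matching (c′ , b′) agree only at c′, so if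
-- both have entry b at c then (c′ , b′) = (c , b).

open import Defs

open import Data.Nat using (ℕ; zero; suc; _^_; _*_; _+_; parity)
open import Data.Nat.Properties using (+-comm; *-suc; ^-*-assoc)
open import Data.Parity.Base using (0ℙ)
open import Data.Bool using (Bool; true; false; not; _xor_)
open import Data.Bool.Properties
  using (not-involutive; not-¬; xor-assoc; xor-comm; xor-same; xor-identityʳ; xor-annihilates-not)
open import Data.Fin using (Fin; zero; suc; _<_; combine; remQuot; punchIn; punchOut)
open import Data.Fin.Properties
  using (_≟_; <-cmp; 2↔Bool; combine-remQuot; remQuot-combine; punchIn-punchOut)
open import Data.Vec using (Vec; []; _∷_; lookup; insertAt; removeAt; map; tail)
open import Data.Vec.Properties
  using (∷-injective; insertAt-lookup; insertAt-punchIn; removeAt-insertAt; lookup-map; map-∘; map-cong; map-id)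
open import Data.Product using (Σ; _×_; _,_; proj₁; proj₂)
open import Data.Sum using (_⊎_; inj₁; inj₂)
open import Data.Empty using (⊥-elim)
open import Function using (_∘_)
open import Function.Bundles using (Inverse)
open import Relation.Binary.Definitions using (tri<; tri≈; tri>)
open import Relation.Binary.PropositionalEquality
open import Relation.Nullary using (¬_; yes; no)

module _ {n : ℕ} where

  _∈₂_ : Fin n → Fin n × Fin n → Set
  a ∈₂ p = (proj₁ p ≡ a) ⊎ (proj₂ p ≡ a)

  _≐_ : Fin n × Fin n → Fin n × Fin n → Set
  p ≐ q = (proj₁ p ≡ proj₁ q × proj₂ p ≡ proj₂ q) ⊎ (proj₁ p ≡ proj₂ q × proj₂ p ≡ proj₁ q)

  ≐-sym : ∀ {p q} → p ≐ q → q ≐ p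
  ≐-sym (inj₁ (e₁ , e₂)) = inj₁ (sym e₁ , sym e₂)
  ≐-sym (inj₂ (e₁ , e₂)) = inj₂ (sym e₂ , sym e₁)

  ≐-swap : ∀ {p u v} → p ≐ (u , v) → p ≐ (v , u)
  ≐-swap (inj₁ (e₁ , e₂)) = inj₂ (e₁ , e₂)
  ≐-swap (inj₂ (e₁ , e₂)) = inj₁ (e₁ , e₂)

  ≐-trans : ∀ {p q s} → p ≐ q → q ≐ s → p ≐ s
  ≐-trans (inj₁ (refl , refl)) q≐s = q≐s
  ≐-trans (inj₂ (refl , refl)) (inj₁ (e₁ , e₂)) = inj₂ (e₂ , e₁)
  ≐-trans (inj₂ (refl , refl)) (inj₂ (e₁ , e₂)) = inj₁ (e₂ , e₁)

  ∈₂-resp-≐ : ∀ {a p q} → a ∈₂ p → p ≐ q → a ∈₂ q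
  ∈₂-resp-≐ (inj₁ refl) (inj₁ (e , _)) = inj₁ (sym e)
  ∈₂-resp-≐ (inj₂ refl) (inj₁ (_ , e)) = inj₂ (sym e)
  ∈₂-resp-≐ (inj₁ refl) (inj₂ (e , _)) = inj₂ (sym e)
  ∈₂-resp-≐ (inj₂ refl) (inj₂ (_ , e)) = inj₁ (sym e)

  sortPair : Fin n × Fin n → Fin n × Fin n
  sortPair (a , b) with <-cmp a b
  ... | tri< _ _ _ = a , b
  ... | tri≈ _ _ _ = a , b
  ... | tri> _ _ _ = b , a

  sortPair-≐ : ∀ p → sortPair p ≐ p
  sortPair-≐ (a , b) with <-cmp a b
  ... | tri< _ _ _ = inj₁ (refl , refl)
  ... | tri≈ _ _ _ = inj₁ (refl , refl)
  ... | tri> _ _ _ = inj₂ (refl , refl)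

  sortPair-< : ∀ p → proj₁ p ≢ proj₂ p → proj₁ (sortPair p) < proj₂ (sortPair p)
  sortPair-< (a , b) a≢b with <-cmp a b
  ... | tri< a<b _ _ = a<b
  ... | tri≈ _ a≡b _ = ⊥-elim (a≢b a≡b)
  ... | tri> _ _ b<a = b<a

  sortPair-unique : ∀ {p u v} → u < v → p ≐ (u , v) → sortPair p ≡ (u , v)
  sortPair-unique {u = u} {v} u<v (inj₁ (refl , refl)) with <-cmp u v
  ... | tri< _ _ _ = refl
  ... | tri≈ ¬u<v _ _ = ⊥-elim (¬u<v u<v)
  ... | tri> ¬u<v _ _ = ⊥-elim (¬u<v u<v)
  sortPair-unique {u = u} {v} u<v (inj₂ (refl , refl)) with <-cmp v u
  ... | tri< _ _ ¬u<v = ⊥-elim (¬u<v u<v)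
  ... | tri≈ _ _ ¬u<v = ⊥-elim (¬u<v u<v)
  ... | tri> _ _ _ = refl

RSGraph : (n r t : ℕ) → Set₁
RSGraph n r t = Σ (SimpleGraph n) λ G → IsRuzsaSzemeredi G r t

RSGraph-cast : ∀ {n r t n′ r′ t′} → n ≡ n′ → r ≡ r′ → t ≡ t′ → RSGraph n r t → RSGraph n′ r′ t′
RSGraph-cast refl refl refl G = G

CoveredBy : ∀ {n r t} → (Fin t → Fin r → Fin n × Fin n) → Fin t → Fin n → Set
CoveredBy {r = r} edge k a = Σ (Fin r) λ i → a ∈₂ edge k i

module FromInducedMatchings
  {n r t : ℕ} (edge : Fin t → Fin r → Fin n × Fin n)
  (loopless : ∀ k i → proj₁ (edge k i) ≢ proj₂ (edge k i))
  (disjoint : ∀ k {i j a} → a ∈₂ edge k i → a ∈₂ edge k j → i ≡ j)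
  (induced : ∀ k k′ i′ → CoveredBy edge k (proj₁ (edge k′ i′)) →
             CoveredBy edge k (proj₂ (edge k′ i′)) → k′ ≡ k)
  where

  graph : SimpleGraph n
  graph = record { Adj = Joined ; symm = λ (ki , e) → ki , ≐-swap e ; irrefl = noLoop }
    where
      Joined : Fin n → Fin n → Set
      Joined u v = Σ (Fin t × Fin r) λ ki → edge (proj₁ ki) (proj₂ ki) ≐ (u , v)
      noLoop : ∀ {u} → ¬ Joined u u
      noLoop ((k , i) , inj₁ (e₁ , e₂)) = loopless k i (trans e₁ (sym e₂))
      noLoop ((k , i) , inj₂ (e₁ , e₂)) = loopless k i (trans e₁ (sym e₂))

  coveredEdge : ∀ k {k′ i′ x y} → CoveredBy edge k x → CoveredBy edge k y → edge k′ i′ ≐ (x , y) → k′ ≡ k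
  coveredEdge k {k′} {i′} cx cy (inj₁ (refl , refl)) = induced k k′ i′ cx cy
  coveredEdge k {k′} {i′} cx cy (inj₂ (refl , refl)) = induced k k′ i′ cy cx

  sameEdge : ∀ {k i k′ i′ p} → edge k i ≐ p → edge k′ i′ ≐ p → k′ ≡ k × i′ ≡ i
  sameEdge {k} {i} {p = u , v} e e′
    with coveredEdge k (i , ∈₂-resp-≐ (inj₁ refl) (≐-sym e)) (i , ∈₂-resp-≐ (inj₂ refl) (≐-sym e)) e′
  ... | refl = refl , disjoint k (inj₁ refl) (∈₂-resp-≐ (∈₂-resp-≐ (inj₁ refl) e′) (≐-sym e))

  matching : Fin t → Fin r → Fin n × Fin n
  matching k i = sortPair (edge k i)

  edge≐matching : ∀ k i → edge k i ≐ matching k i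
  edge≐matching k i = ≐-sym (sortPair-≐ (edge k i))

  matching-ends : ∀ {k i a} → a ∈₂ matching k i → a ∈₂ edge k i
  matching-ends {k} {i} a∈ = ∈₂-resp-≐ a∈ (sortPair-≐ (edge k i))

  isInduced : ∀ k → IsInducedMatching graph (matching k)
  isInduced k = isEdge , injective , endsDistinct , inducedness
    where
      isEdge : ∀ i → proj₁ (matching k i) < proj₂ (matching k i) × Adj graph (proj₁ (matching k i)) (proj₂ (matching k i))
      isEdge i = sortPair-< (edge k i) (loopless k i) , (k , i) , edge≐matching k i

      injective : ∀ i j → matching k i ≡ matching k j → i ≡ j
      injective i j eq = proj₂ (sameEdge (edge≐matching k j) (subst (edge k i ≐_) eq (edge≐matching k i)))

      endsDistinct : ∀ i j → i ≢ j →
        (proj₁ (matching k i) ≢ proj₁ (matching k j)) × (proj₁ (matching k i) ≢ proj₂ (matching k j))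
        × (proj₂ (matching k i) ≢ proj₂ (matching k j))
      endsDistinct i j i≢j =
          (λ e → i≢j (disjoint k (matching-ends (inj₁ refl)) (matching-ends (inj₁ (sym e)))))
        , (λ e → i≢j (disjoint k (matching-ends (inj₁ refl)) (matching-ends (inj₂ (sym e)))))
        , (λ e → i≢j (disjoint k (matching-ends (inj₂ refl)) (matching-ends (inj₂ (sym e)))))

      inducedness : ∀ x y → CoveredBy matching k x → CoveredBy matching k y → Adj graph x y →
                    Σ (Fin r) λ i → matching k i ≐ (x , y)
      inducedness x y (i , x∈) (j , y∈) ((k′ , i′) , e) with coveredEdge k (i , matching-ends x∈) (j , matching-ends y∈) e
      ... | refl = i′ , ≐-trans (sortPair-≐ (edge k i′)) e

  isRuzsaSzemeredi : IsRuzsaSzemeredi graph r t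
  isRuzsaSzemeredi = matching , isInduced , uniqueLabel
    where
      uniqueLabel : ∀ (e : Edge graph) → Σ (Fin t × Fin r) λ ki →
          (matching (proj₁ ki) (proj₂ ki) ≡ proj₁ e)
        × (∀ (kj : Fin t × Fin r) → matching (proj₁ kj) (proj₂ kj) ≡ proj₁ e → kj ≡ ki)
      uniqueLabel (_ , u<v , (k , i) , e) = (k , i) , sortPair-unique u<v e , λ where
        (k′ , i′) eq → let k′≡k , i′≡i = sameEdge e (subst (edge k′ i′ ≐_) eq (edge≐matching k′ i′))
                       in cong₂ _,_ k′≡k i′≡i

  rsGraph : RSGraph n r t
  rsGraph = graph , isRuzsaSzemeredi

module _ where
  open Inverse 2↔Bool using (to; from; strictlyInverseˡ; strictlyInverseʳ)

  encode : ∀ {n} → Vec Bool n → Fin (2 ^ n)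
  encode []      = zero
  encode (b ∷ v) = combine (from b) (encode v)

  decode : ∀ n → Fin (2 ^ n) → Vec Bool n
  decode zero    _ = []
  decode (suc n) i = to (proj₁ (remQuot {2} (2 ^ n) i)) ∷ decode n (proj₂ (remQuot {2} (2 ^ n) i))

  decode-encode : ∀ {n} (v : Vec Bool n) → decode n (encode v) ≡ v
  decode-encode []              = refl
  decode-encode {suc n} (b ∷ v) = begin
    decode (suc n) (combine (from b) (encode v)) ≡⟨ cong (λ qr → to (proj₁ qr) ∷ decode n (proj₂ qr))
                                                         (remQuot-combine (from b) (encode v)) ⟩
    to (from b) ∷ decode n (encode v)            ≡⟨ cong₂ _∷_ (strictlyInverseˡ b) (decode-encode v) ⟩
    b ∷ v                                        ∎
    where open ≡-Reasoning

  encode-decode : ∀ n (i : Fin (2 ^ n)) → encode (decode n i) ≡ i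
  encode-decode zero    zero = refl
  encode-decode (suc n) i    = begin
    combine (from (to q)) (encode (decode n r)) ≡⟨ cong₂ combine (strictlyInverseʳ q) (encode-decode n r) ⟩
    combine q r                                 ≡⟨ combine-remQuot {2} (2 ^ n) i ⟩
    i                                           ∎
    where
      open ≡-Reasoning
      q = proj₁ (remQuot {2} (2 ^ n) i)
      r = proj₂ (remQuot {2} (2 ^ n) i)

  decode-injective : ∀ n {i j : Fin (2 ^ n)} → decode n i ≡ decode n j → i ≡ j
  decode-injective n {i} {j} eq =
    trans (sym (encode-decode n i)) (trans (cong encode eq) (encode-decode n j))

xorSum : ∀ {n} → Vec Bool n → Bool
xorSum []      = false
xorSum (a ∷ v) = a xor xorSum v

xor≡false⇒≡ : ∀ a b → a xor b ≡ false → b ≡ a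
xor≡false⇒≡ false b     e = e
xor≡false⇒≡ true  true  _ = refl

xorSum-insertAt : ∀ {n} (v : Vec Bool n) c b → xorSum (insertAt v c b) ≡ b xor xorSum v
xorSum-insertAt v       zero    b = refl
xorSum-insertAt (a ∷ v) (suc c) b = begin
  a xor xorSum (insertAt v c b) ≡⟨ cong (a xor_) (xorSum-insertAt v c b) ⟩
  a xor (b xor xorSum v)        ≡⟨ sym (xor-assoc a b (xorSum v)) ⟩
  (a xor b) xor xorSum v        ≡⟨ cong (_xor xorSum v) (xor-comm a b) ⟩
  (b xor a) xor xorSum v        ≡⟨ xor-assoc b a (xorSum v) ⟩
  b xor (a xor xorSum v)        ∎
  where open ≡-Reasoning

xorSum-complement : ∀ {n} → parity n ≡ 0ℙ → (v : Vec Bool n) → xorSum (map not v) ≡ xorSum v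
xorSum-complement _    []          = refl
xorSum-complement even (a ∷ b ∷ v) = begin
  not a xor (not b xor xorSum (map not v)) ≡⟨ cong (λ s → not a xor (not b xor s)) (xorSum-complement even v) ⟩
  not a xor (not b xor xorSum v)           ≡⟨ sym (xor-assoc (not a) (not b) (xorSum v)) ⟩
  (not a xor not b) xor xorSum v           ≡⟨ cong (_xor xorSum v) (xor-annihilates-not a b) ⟩
  (a xor b) xor xorSum v                   ≡⟨ xor-assoc a b (xorSum v) ⟩
  a xor (b xor xorSum v)                   ∎
  where open ≡-Reasoning

-- Even words of length n + 1 are in bijection with Fin (2 ^ n): drop the
-- first entry and encode the rest; conversely complete a decoded word by
-- its parity.
module _ {n : ℕ} where

  vertexOf : Vec Bool (suc n) → Fin (2 ^ n)
  vertexOf Z = encode (tail Z)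

  wordOf : Fin (2 ^ n) → Vec Bool (suc n)
  wordOf a = xorSum v ∷ v
    where v = decode n a

  wordOf-vertexOf : ∀ Z → xorSum Z ≡ false → wordOf (vertexOf Z) ≡ Z
  wordOf-vertexOf (a ∷ v) even rewrite decode-encode v = cong (_∷ v) (xor≡false⇒≡ a (xorSum v) even)

pole₀ pole₁ : ∀ {n} → Fin (suc n) → Bool → Vec Bool n → Vec Bool (suc n)
pole₀ c b u = insertAt u c b
pole₁ c b u = insertAt (map not u) c b

poles-differ : ∀ {n} c b (u : Vec Bool n) {j} → c ≢ j →
               lookup (pole₁ c b u) j ≡ not (lookup (pole₀ c b u) j)
poles-differ c b u {j} c≢j =
  subst (λ j → lookup (pole₁ c b u) j ≡ not (lookup (pole₀ c b u) j)) (punchIn-punchOut c≢j) (begin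
    lookup (insertAt (map not u) c b) (punchIn c j′) ≡⟨ insertAt-punchIn (map not u) c b j′ ⟩
    lookup (map not u) j′                            ≡⟨ lookup-map j′ not u ⟩
    not (lookup u j′)                                ≡⟨ cong not (insertAt-punchIn u c b j′) ⟨
    not (lookup (insertAt u c b) (punchIn c j′))     ∎)
  where
    open ≡-Reasoning
    j′ = punchOut c≢j

poles-agree-only-at : ∀ {n} c b (u : Vec Bool n) {j β} →
  lookup (pole₀ c b u) j ≡ β → lookup (pole₁ c b u) j ≡ β → c ≡ j × b ≡ β
poles-agree-only-at c b u {j} e₀ e₁ with c ≟ j
... | yes refl = refl , trans (sym (insertAt-lookup u c b)) e₀
... | no c≢j   = ⊥-elim (not-¬ e₁ (trans (poles-differ c b u c≢j) (cong not e₀)))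

poles-distinct : ∀ {n} c b (u : Vec Bool (suc n)) → pole₀ c b u ≢ pole₁ c b u
poles-distinct c b (x ∷ u) eq = not-¬ refl (proj₁ (∷-injective (begin
  x ∷ u                              ≡⟨ removeAt-insertAt (x ∷ u) c b ⟨
  removeAt (pole₀ c b (x ∷ u)) c     ≡⟨ cong (λ Z → removeAt Z c) eq ⟩
  removeAt (pole₁ c b (x ∷ u)) c     ≡⟨ removeAt-insertAt (map not (x ∷ u)) c b ⟩
  not x ∷ map not u                  ∎)))
  where open ≡-Reasoning

pole₀-even : ∀ {n} c b (u : Vec Bool n) → xorSum u ≡ b → xorSum (pole₀ c b u) ≡ false
pole₀-even c b u refl = trans (xorSum-insertAt u c b) (xor-same b)

pole₁-even : ∀ {n} → parity n ≡ 0ℙ → ∀ c b (u : Vec Bool n) → xorSum u ≡ b → xorSum (pole₁ c b u) ≡ false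
pole₁-even even c b u refl = begin
  xorSum (insertAt (map not u) c b) ≡⟨ xorSum-insertAt (map not u) c b ⟩
  b xor xorSum (map not u)          ≡⟨ cong (b xor_) (xorSum-complement even u) ⟩
  b xor b                           ≡⟨ xor-same b ⟩
  false                             ∎
  where open ≡-Reasoning

-- Vertices are the even words
-- of length K + 3 (there are 2 ^ (K + 2) of them); matchings are labelled
-- by a coordinate c and a bit b (2 (K + 3) labels), and the matching (c , b)
-- pairs every even word with entry b at c with its antipode through c.
-- Each such pair is listed once, via the base word with leading entry false
-- and parity b, followed by a free word w of length K (2 ^ K edges).
module FoldedCube (K : ℕ) (K-even : parity K ≡ 0ℙ) where
  open Inverse 2↔Bool using (to; strictlyInverseʳ)

  Label : Set
  Label = Fin (2 * (3 + K))

  coord : Label → Fin (3 + K)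
  coord k = proj₂ (remQuot {2} (3 + K) k)

  side : Label → Bool
  side k = to (proj₁ (remQuot {2} (3 + K) k))

  label-injective : ∀ {k k′} → coord k ≡ coord k′ → side k ≡ side k′ → k ≡ k′
  label-injective {k} {k′} c≡ b≡ = begin
    k                              ≡⟨ combine-remQuot {2} (3 + K) k ⟨
    combine (proj₁ qr) (proj₂ qr)  ≡⟨ cong₂ combine side≡ c≡ ⟩
    combine (proj₁ qr′) (proj₂ qr′) ≡⟨ combine-remQuot {2} (3 + K) k′ ⟩
    k′                             ∎
    where
      open ≡-Reasoning
      qr  = remQuot {2} (3 + K) k
      qr′ = remQuot {2} (3 + K) k′
      side≡ : proj₁ qr ≡ proj₁ qr′
      side≡ = trans (sym (strictlyInverseʳ _)) (trans (cong (Inverse.from 2↔Bool) b≡) (strictlyInverseʳ _))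

  base : Bool → Vec Bool K → Vec Bool (2 + K)
  base b w = false ∷ (b xor xorSum w) ∷ w

  xorSum-base : ∀ b w → xorSum (base b w) ≡ b
  xorSum-base b w = begin
    (b xor xorSum w) xor xorSum w ≡⟨ xor-assoc b (xorSum w) (xorSum w) ⟩
    b xor (xorSum w xor xorSum w) ≡⟨ cong (b xor_) (xor-same (xorSum w)) ⟩
    b xor false                   ≡⟨ xor-identityʳ b ⟩
    b                             ∎
    where open ≡-Reasoning

  -- Recovers the free word from a base word or from its complement.
  unbase : Vec Bool (2 + K) → Vec Bool K
  unbase (false ∷ _ ∷ w) = w
  unbase (true  ∷ _ ∷ w) = map not w

  unbase-complement : ∀ b w → unbase (map not (base b w)) ≡ w
  unbase-complement b w = begin
    map not (map not w) ≡⟨ map-∘ not not w ⟨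
    map (not ∘ not) w   ≡⟨ map-cong not-involutive w ⟩
    map (λ x → x) w     ≡⟨ map-id w ⟩
    w                   ∎
    where open ≡-Reasoning

  end₀ end₁ : Label → Fin (2 ^ K) → Vec Bool (3 + K)
  end₀ k i = pole₀ (coord k) (side k) (base (side k) (decode K i))
  end₁ k i = pole₁ (coord k) (side k) (base (side k) (decode K i))

  edge : Label → Fin (2 ^ K) → Fin (2 ^ (2 + K)) × Fin (2 ^ (2 + K))
  edge k i = vertexOf (end₀ k i) , vertexOf (end₁ k i)

  wordOf-end₀ : ∀ k i → wordOf (vertexOf (end₀ k i)) ≡ end₀ k i
  wordOf-end₀ k i = wordOf-vertexOf _ (pole₀-even (coord k) (side k) _ (xorSum-base (side k) (decode K i)))

  wordOf-end₁ : ∀ k i → wordOf (vertexOf (end₁ k i)) ≡ end₁ k i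
  wordOf-end₁ k i = wordOf-vertexOf _ (pole₁-even K-even (coord k) (side k) _ (xorSum-base (side k) (decode K i)))

  end-coordinate : ∀ {k i a} → a ∈₂ edge k i → lookup (wordOf a) (coord k) ≡ side k
  end-coordinate {k} {i} (inj₁ refl) =
    trans (cong (λ Z → lookup Z (coord k)) (wordOf-end₀ k i)) (insertAt-lookup _ (coord k) (side k))
  end-coordinate {k} {i} (inj₂ refl) =
    trans (cong (λ Z → lookup Z (coord k)) (wordOf-end₁ k i)) (insertAt-lookup _ (coord k) (side k))

  end-determines-edge : ∀ {k i a} → a ∈₂ edge k i → unbase (removeAt (wordOf a) (coord k)) ≡ decode K i
  end-determines-edge {k} {i} (inj₁ refl) = begin
    unbase (removeAt (wordOf (vertexOf (end₀ k i))) (coord k)) ≡⟨ cong (λ Z → unbase (removeAt Z (coord k))) (wordOf-end₀ k i) ⟩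
    unbase (removeAt (end₀ k i) (coord k))                     ≡⟨ cong unbase (removeAt-insertAt _ (coord k) (side k)) ⟩
    decode K i                                                 ∎
    where open ≡-Reasoning
  end-determines-edge {k} {i} (inj₂ refl) = begin
    unbase (removeAt (wordOf (vertexOf (end₁ k i))) (coord k)) ≡⟨ cong (λ Z → unbase (removeAt Z (coord k))) (wordOf-end₁ k i) ⟩
    unbase (removeAt (end₁ k i) (coord k))                     ≡⟨ cong unbase (removeAt-insertAt _ (coord k) (side k)) ⟩
    unbase (map not (base (side k) (decode K i)))              ≡⟨ unbase-complement (side k) (decode K i) ⟩
    decode K i                                                 ∎
    where open ≡-Reasoning

  loopless : ∀ k i → proj₁ (edge k i) ≢ proj₂ (edge k i)
  loopless k i eq = poles-distinct (coord k) (side k) _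
    (trans (sym (wordOf-end₀ k i)) (trans (cong wordOf eq) (wordOf-end₁ k i)))

  disjoint : ∀ k {i j a} → a ∈₂ edge k i → a ∈₂ edge k j → i ≡ j
  disjoint k a∈i a∈j = decode-injective K (trans (sym (end-determines-edge {k} a∈i)) (end-determines-edge {k} a∈j))

  -- If both ends of an edge of matching k′ have entry side k at coord k,
  -- then, the two ends agreeing only at coord k′, the labels coincide.
  induced : ∀ k k′ i′ → CoveredBy edge k (proj₁ (edge k′ i′)) → CoveredBy edge k (proj₂ (edge k′ i′)) → k′ ≡ k
  induced k k′ i′ (_ , x∈) (_ , y∈) =
    let c≡ , b≡ = poles-agree-only-at (coord k′) (side k′) _
                    (trans (cong (λ Z → lookup Z (coord k)) (sym (wordOf-end₀ k′ i′))) (end-coordinate {k} x∈))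
                    (trans (cong (λ Z → lookup Z (coord k)) (sym (wordOf-end₁ k′ i′))) (end-coordinate {k} y∈))
    in label-injective c≡ b≡

  rsGraph : RSGraph (2 ^ (2 + K)) (2 ^ K) (2 * (3 + K))
  rsGraph = FromInducedMatchings.rsGraph edge loopless disjoint induced

parity-double : ∀ m → parity (2 * m) ≡ 0ℙ
parity-double zero    = refl
parity-double (suc m) = trans (cong parity (*-suc 2 m)) (parity-double m)

corollary3p2 : (m : ℕ) → Σ (SimpleGraph (4 ^ suc m)) λ G →
                 IsRuzsaSzemeredi G (4 ^ m) (2 * (2 * suc m + 1))
corollary3p2 m =
  RSGraph-cast vertexCount matchingSize matchingCount (FoldedCube.rsGraph (2 * m) (parity-double m))
  where
    vertexCount : 2 ^ (2 + 2 * m) ≡ 4 ^ suc m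
    vertexCount = sym (trans (^-*-assoc 2 2 (suc m)) (cong (2 ^_) (*-suc 2 m)))

    matchingSize : 2 ^ (2 * m) ≡ 4 ^ m
    matchingSize = sym (^-*-assoc 2 2 m)

    matchingCount : 2 * (3 + 2 * m) ≡ 2 * (2 * suc m + 1)
    matchingCount = cong (2 *_) (trans (cong (1 +_) (sym (*-suc 2 m))) (+-comm 1 (2 * suc m)))
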